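{- The sign pattern $\begin{bmatrix}+&-&0\\-&0&+\\0&+&0\end{bmatrix}$ requires algebraic positivity.
   Context: For a sign pattern $S$ (matrix with entries in $\{+,-,0\}$), $Q(S)$ is the set of real matrices $X$ with $\mathrm{sgn}(X_{ij})=S_{ij}$ for all $i,j$. A real square matrix $M$ is algebraically positive if there is a real polynomial $p$ with all entries of $p(M)$ positive. $S$ requires algebraic positivity if every $X\in Q(S)$ is algebraically positive. -}

module Defs where

open import Level using (0ℓ)
open import Data.Nat using (ℕ; zero; suc)
open import Data.Fin using (Fin; zero; suc)
open import Data.List using (List; []; _∷_)
open import Data.Product using (Σ; ∃; _×_; _,_)
open import Data.Sum using (_⊎_)
open import Relation.Nullary using (¬_)
open import Relation.Binary.PropositionalEquality using (_≡_)
open import Algebra.Structures using (IsCommutativeRing)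
open import Relation.Binary.Structures using (IsStrictTotalOrder)

-- The real numbers, axiomatised as a complete ordered field.
-- (Any two models are isomorphic, so quantifying over all models is
-- the same as speaking about ℝ.)

record RealField : Set₁ where
  infixl 6 _+_
  infixl 7 _*_
  infix  4 _<_ _≤_
  field
    Carrier : Set
    _+_ _*_ : Carrier → Carrier → Carrier
    -_      : Carrier → Carrier
    0# 1#   : Carrier
    _<_     : Carrier → Carrier → Set
    isCommutativeRing : IsCommutativeRing _≡_ _+_ _*_ -_ 0# 1#
    isStrictTotalOrder : IsStrictTotalOrder _≡_ _<_
    0<1     : 0# < 1#
    +-mono-< : ∀ {x y} z → x < y → x + z < y + z
    *-pos    : ∀ {x y} → 0# < x → 0# < y → 0# < x * y
    inverse  : ∀ x → ¬ (x ≡ 0#) → Σ Carrier (λ y → x * y ≡ 1#)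
  _≤_ : Carrier → Carrier → Set
  x ≤ y = (x < y) ⊎ (x ≡ y)
  field
    complete : (P : Carrier → Set) → ∃ P → (∃ λ u → ∀ x → P x → x ≤ u) →
               ∃ λ s → (∀ x → P x → x ≤ s) × (∀ u → (∀ x → P x → x ≤ u) → s ≤ u)

data Sign : Set where
  ⊕ ⊖ ⊙ : Sign

SignPattern : ℕ → Set
SignPattern n = Fin n → Fin n → Sign

module _ (ℝ : RealField) where
  open RealField ℝ

  Matrix : ℕ → Set
  Matrix n = Fin n → Fin n → Carrier

  HasSign : Sign → Carrier → Set
  HasSign ⊕ x = 0# < x
  HasSign ⊖ x = x < 0#
  HasSign ⊙ x = x ≡ 0#

  InQ : ∀ {n} → SignPattern n → Matrix n → Set
  InQ S X = ∀ i j → HasSign (S i j) (X i j)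

  sumFin : ∀ n → (Fin n → Carrier) → Carrier
  sumFin zero    f = 0#
  sumFin (suc n) f = f zero + sumFin n (λ i → f (suc i))

  _⊗_ : ∀ {n} → Matrix n → Matrix n → Matrix n
  _⊗_ {n} A B i j = sumFin n (λ k → A i k * B k j)

  _⊕ₘ_ : ∀ {n} → Matrix n → Matrix n → Matrix n
  (A ⊕ₘ B) i j = A i j + B i j

  identity : ∀ {n} → Matrix n
  identity i j with i Data.Fin.≟ j
  ... | Relation.Nullary.yes _ = 1#
  ... | Relation.Nullary.no  _ = 0#

  zeroM : ∀ {n} → Matrix n
  zeroM _ _ = 0#

  scale : ∀ {n} → Carrier → Matrix n → Matrix n
  scale c A i j = c * A i j

  -- A real polynomial c₀ + c₁ t + … + c_k t^k, as its coefficient list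
  -- [c₀, c₁, …, c_k]; evaluation at a matrix via Horner's scheme:
  -- p(M) = c₀ I + M (c₁ I + M (…)).
  Poly : Set
  Poly = List Carrier

  evalPoly : ∀ {n} → Poly → Matrix n → Matrix n
  evalPoly []       M = zeroM
  evalPoly (c ∷ cs) M = scale c identity ⊕ₘ (M ⊗ evalPoly cs M)

  AlgebraicallyPositive : ∀ {n} → Matrix n → Set
  AlgebraicallyPositive M = ∃ λ (p : Poly) → ∀ i j → 0# < evalPoly p M i j

  RequiresAlgebraicPositivity : ∀ {n} → SignPattern n → Set
  RequiresAlgebraicPositivity S = ∀ X → InQ S X → AlgebraicallyPositive X

S₅ : SignPattern 3
S₅ zero zero = ⊕
S₅ zero (suc zero) = ⊖
S₅ zero (suc (suc zero)) = ⊙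
S₅ (suc zero) zero = ⊖
S₅ (suc zero) (suc zero) = ⊙
S₅ (suc zero) (suc (suc zero)) = ⊕
S₅ (suc (suc zero)) zero = ⊙
S₅ (suc (suc zero)) (suc zero) = ⊕
S₅ (suc (suc zero)) (suc (suc zero)) = ⊙

module Submission where

-- A matrix X ∈ Q(S₅) is  [ a p 0 ; q 0 d ; 0 e 0 ]  with a, d, e > 0 and p, q < 0.
-- For  f(t) = α + a² t − 2a t²,  α = a³ + 2apq + 2ade + a²,  a direct computation gives
--   f(X) = [ a² + 2ade , −pa² , −2apd ; −qa² , a³ + a² , a²d ; −2aqe , a²e , a³ + 2apq + a² ],
-- and every entry is a sum of products of the positive numbers a, −p, −q, d, e.

open import Defs
open import Level using (Level; 0ℓ)
open import Data.Nat as ℕ using (ℕ; zero; suc)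
open import Data.Integer as ℤ using (ℤ)
import Data.Integer.Properties as ℤ
import Data.Nat.Properties as ℕ
import Data.Sign as Sign
open import Data.Fin as Fin using (Fin; zero; suc)
open import Data.Fin.Patterns using (0F; 1F; 2F; 3F; 4F)
open import Data.Vec using (Vec; []; _∷_)
open import Data.List as List using (List; []; _∷_)
open import Data.Product using (_,_)
open import Data.Maybe using (Maybe; just; nothing)
open import Relation.Nullary using (yes; no)
import Relation.Binary.PropositionalEquality as ≡
open import Algebra.Bundles using (CommutativeRing)
open import Algebra.Structures using (IsCommutativeRing)
open import Relation.Binary.Structures using (IsStrictTotalOrder)
import Algebra.Solver.Ring
open import Algebra.Solver.Ring.AlmostCommutativeRing
  using (_-Raw-AlmostCommutative⟶_; fromCommutativeRing)

module IntegerCoefficients {c ℓ : Level} (R : CommutativeRing c ℓ) where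
  open CommutativeRing R
  open import Algebra.Properties.Ring ring
    using (-‿involutive; -0#≈0#; -‿distribˡ-*; -‿distribʳ-*; -‿+-comm)
  open import Algebra.Properties.Semiring.Mult.TCOptimised semiring
    using (_×_; ×-homo-+; ×1-homo-*)
  open import Relation.Binary.Reasoning.Setoid setoid

  -- The canonical maps ℕ → R and ℤ → R.  The optimised multiple _×_ makes
  -- fromℕ 0 and fromℕ 1 reduce to 0# and 1#, so constants evaluate definitionally.
  fromℕ : ℕ → Carrier
  fromℕ n = n × 1#

  fromℤ : ℤ → Carrier
  fromℤ (ℤ.+ n)    = fromℕ n
  fromℤ ℤ.-[1+ n ] = - fromℕ (suc n)

  cancel-+ˡ : ∀ z x y → (z + x) + - (z + y) ≈ x + - y
  cancel-+ˡ z x y = begin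
    (z + x) + - (z + y)    ≈⟨ +-congˡ (-‿+-comm z y) ⟨
    (z + x) + (- z + - y)  ≈⟨ +-assoc z x (- z + - y) ⟩
    z + (x + (- z + - y))  ≈⟨ +-congˡ (+-assoc x (- z) (- y)) ⟨
    z + ((x + - z) + - y)  ≈⟨ +-congˡ (+-congʳ (+-comm x (- z))) ⟩
    z + ((- z + x) + - y)  ≈⟨ +-congˡ (+-assoc (- z) x (- y)) ⟩
    z + (- z + (x + - y))  ≈⟨ +-assoc z (- z) (x + - y) ⟨
    (z + - z) + (x + - y)  ≈⟨ +-congʳ (-‿inverseʳ z) ⟩
    0# + (x + - y)         ≈⟨ +-identityˡ (x + - y) ⟩
    x + - y                ∎

  fromℤ-⊖ : ∀ m n → fromℤ (m ℤ.⊖ n) ≈ fromℕ m + - fromℕ n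
  fromℤ-⊖ m zero rewrite ℤ.⊖-≥ {m} {0} ℕ.z≤n = begin
    fromℕ m        ≈⟨ +-identityʳ (fromℕ m) ⟨
    fromℕ m + 0#   ≈⟨ +-congˡ -0#≈0# ⟨
    fromℕ m + - 0# ∎
  fromℤ-⊖ zero (suc n) rewrite ℤ.⊖-≤ {0} {suc n} ℕ.z≤n =
    sym (+-identityˡ (- fromℕ (suc n)))
  fromℤ-⊖ (suc m) (suc n) rewrite ℤ.[1+m]⊖[1+n]≡m⊖n m n = begin
    fromℤ (m ℤ.⊖ n)                     ≈⟨ fromℤ-⊖ m n ⟩
    fromℕ m + - fromℕ n                 ≈⟨ cancel-+ˡ 1# (fromℕ m) (fromℕ n) ⟨
    (1# + fromℕ m) + - (1# + fromℕ n)  ≈⟨ +-cong (×-homo-+ 1# 1 m) (-‿cong (×-homo-+ 1# 1 n)) ⟨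
    fromℕ (suc m) + - fromℕ (suc n)     ∎

  fromℤ-+ : ∀ i j → fromℤ (i ℤ.+ j) ≈ fromℤ i + fromℤ j
  fromℤ-+ (ℤ.+ m)    (ℤ.+ n)    = ×-homo-+ 1# m n
  fromℤ-+ (ℤ.+ m)    ℤ.-[1+ n ] = fromℤ-⊖ m (suc n)
  fromℤ-+ ℤ.-[1+ m ] (ℤ.+ n)    = trans (fromℤ-⊖ n (suc m)) (+-comm _ _)
  fromℤ-+ ℤ.-[1+ m ] ℤ.-[1+ n ] = begin
    - fromℕ (suc (suc (m ℕ.+ n)))      ≡⟨ ≡.cong (λ k → - fromℕ (suc k)) (ℕ.+-suc m n) ⟨
    - fromℕ (suc m ℕ.+ suc n)          ≈⟨ -‿cong (×-homo-+ 1# (suc m) (suc n)) ⟩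
    - (fromℕ (suc m) + fromℕ (suc n))  ≈⟨ -‿+-comm _ _ ⟨
    - fromℕ (suc m) + - fromℕ (suc n)  ∎

  signed : Sign.Sign → Carrier → Carrier
  signed Sign.+ x = x
  signed Sign.- x = - x

  signed-* : ∀ s t x y → signed (s Sign.* t) (x * y) ≈ signed s x * signed t y
  signed-* Sign.+ Sign.+ x y = refl
  signed-* Sign.+ Sign.- x y = -‿distribʳ-* x y
  signed-* Sign.- Sign.+ x y = -‿distribˡ-* x y
  signed-* Sign.- Sign.- x y = begin
    x * y         ≈⟨ -‿involutive (x * y) ⟨
    - - (x * y)   ≈⟨ -‿cong (-‿distribˡ-* x y) ⟩
    - (- x * y)   ≈⟨ -‿distribʳ-* (- x) y ⟩
    - x * - y     ∎

  -- fromℤ in sign–magnitude form, the form in which integer multiplication is defined.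
  fromℤ-◃ : ∀ s n → fromℤ (s ℤ.◃ n) ≈ signed s (fromℕ n)
  fromℤ-◃ Sign.+ zero    = refl
  fromℤ-◃ Sign.- zero    = sym -0#≈0#
  fromℤ-◃ Sign.+ (suc n) = refl
  fromℤ-◃ Sign.- (suc n) = refl

  fromℤ-signAbs : ∀ i → fromℤ i ≈ signed (ℤ.sign i) (fromℕ ℤ.∣ i ∣)
  fromℤ-signAbs (ℤ.+ zero)  = refl
  fromℤ-signAbs (ℤ.+ suc n) = refl
  fromℤ-signAbs ℤ.-[1+ n ]  = refl

  fromℤ-* : ∀ i j → fromℤ (i ℤ.* j) ≈ fromℤ i * fromℤ j
  fromℤ-* i j = begin
    fromℤ (s ℤ.◃ ∣i∣ ℕ.* ∣j∣)                          ≈⟨ fromℤ-◃ s (∣i∣ ℕ.* ∣j∣) ⟩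
    signed s (fromℕ (∣i∣ ℕ.* ∣j∣))                      ≈⟨ signed-cong s (×1-homo-* ∣i∣ ∣j∣) ⟩
    signed s (fromℕ ∣i∣ * fromℕ ∣j∣)                    ≈⟨ signed-* (ℤ.sign i) (ℤ.sign j) _ _ ⟩
    signed (ℤ.sign i) (fromℕ ∣i∣) * signed (ℤ.sign j) (fromℕ ∣j∣) ≈⟨ *-cong (fromℤ-signAbs i) (fromℤ-signAbs j) ⟨
    fromℤ i * fromℤ j                                   ∎
    where
    s : Sign.Sign
    s = ℤ.sign i Sign.* ℤ.sign j
    ∣i∣ ∣j∣ : ℕ
    ∣i∣ = ℤ.∣ i ∣
    ∣j∣ = ℤ.∣ j ∣
    signed-cong : ∀ t {x y} → x ≈ y → signed t x ≈ signed t y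
    signed-cong Sign.+ x≈y = x≈y
    signed-cong Sign.- x≈y = -‿cong x≈y

  fromℤ-neg : ∀ i → fromℤ (ℤ.- i) ≈ - fromℤ i
  fromℤ-neg (ℤ.+ zero)  = sym -0#≈0#
  fromℤ-neg (ℤ.+ suc n) = refl
  fromℤ-neg ℤ.-[1+ n ]  = sym (-‿involutive _)

  fromℤ-homomorphism : ℤ.+-*-rawRing -Raw-AlmostCommutative⟶ fromCommutativeRing R
  fromℤ-homomorphism = record
    { ⟦_⟧ = fromℤ ; +-homo = fromℤ-+ ; *-homo = fromℤ-* ; -‿homo = fromℤ-neg
    ; 0-homo = refl ; 1-homo = refl }

  -- A weak test for equality of coefficients; the solver uses it to drop
  -- zero coefficients, which is what makes normal forms canonical.
  fromℤ-≟ : ∀ i j → Maybe (fromℤ i ≈ fromℤ j)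
  fromℤ-≟ i j with i ℤ.≟ j
  ... | yes ≡.refl = just refl
  ... | no _       = nothing

  module Solver = Algebra.Solver.Ring ℤ.+-*-rawRing (fromCommutativeRing R) fromℤ-homomorphism fromℤ-≟
  open Solver public using (Polynomial; con; var; _:+_; _:*_; :-_; ⟦_⟧; normalise)

  equal-by-normalisation : ∀ {m} (p q : Polynomial m) → normalise p ≡.≡ normalise q →
                           ∀ ρ → ⟦ p ⟧ ρ ≈ ⟦ q ⟧ ρ
  equal-by-normalisation p q same-normal-form ρ = begin
    ⟦ p ⟧ ρ                    ≈⟨ Solver.correct p ρ ⟨
    Solver.⟦ normalise p ⟧N ρ  ≡⟨ ≡.cong (λ n → Solver.⟦ n ⟧N ρ) same-normal-form ⟩
    Solver.⟦ normalise q ⟧N ρ  ≈⟨ Solver.correct q ρ ⟩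
    ⟦ q ⟧ ρ                    ∎

-- Evaluating the symbolic p(M) at a point
-- gives p evaluated at the evaluated matrix, so identities between entries of
-- p(M) reduce to polynomial identities decidable by normalisation.
module SymbolicMatrices (ℝ : RealField) where
  open RealField ℝ using (Carrier; _+_; _*_; isCommutativeRing)
  open ≡ using (_≡_; refl; cong; cong₂; trans)

  ringOfReals : CommutativeRing 0ℓ 0ℓ
  ringOfReals = record { isCommutativeRing = isCommutativeRing }

  open IntegerCoefficients ringOfReals public
    using (Polynomial; con; var; _:+_; _:*_; :-_; ⟦_⟧; normalise; equal-by-normalisation)

  SymbolicMatrix : ℕ → ℕ → Set
  SymbolicMatrix m n = Fin n → Fin n → Polynomial m

  evalMatrix : ∀ {m n} → SymbolicMatrix m n → Vec Carrier m → Matrix ℝ n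
  evalMatrix M ρ i j = ⟦ M i j ⟧ ρ

  symbolicIdentity : ∀ {m n} → SymbolicMatrix m n
  symbolicIdentity i j with i Fin.≟ j
  ... | yes _ = con (ℤ.+ 1)
  ... | no  _ = con (ℤ.+ 0)

  symbolicSum : ∀ {m} n → (Fin n → Polynomial m) → Polynomial m
  symbolicSum zero    f = con (ℤ.+ 0)
  symbolicSum (suc n) f = f zero :+ symbolicSum n (λ k → f (suc k))

  symbolicEvalPoly : ∀ {m n} → List (Polynomial m) → SymbolicMatrix m n → SymbolicMatrix m n
  symbolicEvalPoly         []       M i j = con (ℤ.+ 0)
  symbolicEvalPoly {n = n} (c ∷ cs) M i j =
    (c :* symbolicIdentity i j) :+ symbolicSum n (λ k → M i k :* symbolicEvalPoly cs M k j)

  evalMatrix-identity : ∀ {m n} (ρ : Vec Carrier m) (i j : Fin n) →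
                        ⟦ symbolicIdentity i j ⟧ ρ ≡ identity ℝ i j
  evalMatrix-identity ρ i j with i Fin.≟ j
  ... | yes _ = refl
  ... | no  _ = refl

  evalMatrix-sum : ∀ {m} n (f : Fin n → Polynomial m) (ρ : Vec Carrier m) →
                   ⟦ symbolicSum n f ⟧ ρ ≡ sumFin ℝ n (λ k → ⟦ f k ⟧ ρ)
  evalMatrix-sum zero    f ρ = refl
  evalMatrix-sum (suc n) f ρ = cong (⟦ f zero ⟧ ρ +_) (evalMatrix-sum n (λ k → f (suc k)) ρ)

  sumFin-cong : ∀ n {f g : Fin n → Carrier} → (∀ k → f k ≡ g k) → sumFin ℝ n f ≡ sumFin ℝ n g
  sumFin-cong zero    f≗g = refl
  sumFin-cong (suc n) f≗g = cong₂ _+_ (f≗g zero) (sumFin-cong n (λ k → f≗g (suc k)))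

  evalMatrix-evalPoly : ∀ {m n} (cs : List (Polynomial m)) (M : SymbolicMatrix m n) (ρ : Vec Carrier m) →
                        ∀ i j → ⟦ symbolicEvalPoly cs M i j ⟧ ρ ≡
                                evalPoly ℝ (List.map (λ c → ⟦ c ⟧ ρ) cs) (evalMatrix M ρ) i j
  evalMatrix-evalPoly         []       M ρ i j = refl
  evalMatrix-evalPoly {n = n} (c ∷ cs) M ρ i j = cong₂ _+_
    (cong (⟦ c ⟧ ρ *_) (evalMatrix-identity ρ i j))
    (trans (evalMatrix-sum n (λ k → M i k :* symbolicEvalPoly cs M k j) ρ)
           (sumFin-cong n (λ k → cong (⟦ M i k ⟧ ρ *_) (evalMatrix-evalPoly cs M ρ k j))))

  -- Matrices are functions, so p(A) and p(B) must be compared entrywise.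
  evalPoly-cong : ∀ {n} (p : Poly ℝ) {A B : Matrix ℝ n} → (∀ i j → A i j ≡ B i j) →
                  ∀ i j → evalPoly ℝ p A i j ≡ evalPoly ℝ p B i j
  evalPoly-cong         []       A≗B i j = refl
  evalPoly-cong {n = n} (c ∷ cs) A≗B i j = cong (c * identity ℝ i j +_)
    (sumFin-cong n (λ k → cong₂ _*_ (A≗B i k) (evalPoly-cong cs A≗B k j)))

module OrderedFieldFacts (ℝ : RealField) where
  open RealField ℝ using (Carrier; 0#; _+_; -_; _<_; isCommutativeRing; isStrictTotalOrder; +-mono-<)
  open IsCommutativeRing isCommutativeRing using (+-identityˡ; -‿inverseʳ)
  open IsStrictTotalOrder isStrictTotalOrder using () renaming (trans to <-trans)
  open ≡ using (subst; subst₂)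

  +-pos : ∀ {x y} → 0# < x → 0# < y → 0# < x + y
  +-pos {x} {y} 0<x 0<y = <-trans 0<y (subst (_< x + y) (+-identityˡ y) (+-mono-< y 0<x))

  neg-pos : ∀ {x} → x < 0# → 0# < - x
  neg-pos {x} x<0 = subst₂ _<_ (-‿inverseʳ x) (+-identityˡ (- x)) (+-mono-< (- x) x<0)

module PatternS₅ (ℝ : RealField) where
  open RealField ℝ using (Carrier; 0#; _+_; _*_; -_; _<_; *-pos)
  open SymbolicMatrices ℝ
  open OrderedFieldFacts ℝ
  open ≡ using (_≡_; refl; module ≡-Reasoning)

  a p q d e : Polynomial 5
  a = var 0F
  p = var 1F
  q = var 2F
  d = var 3F
  e = var 4F

  two : Polynomial 5 → Polynomial 5
  two x = x :+ x

  genericS₅ : SymbolicMatrix 5 3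
  genericS₅ 0F 0F = a
  genericS₅ 0F 1F = p
  genericS₅ 1F 0F = q
  genericS₅ 1F 2F = d
  genericS₅ 2F 1F = e
  genericS₅ _  _  = con (ℤ.+ 0)

  entries : Matrix ℝ 3 → Vec Carrier 5
  entries X = X 0F 0F ∷ X 0F 1F ∷ X 1F 0F ∷ X 1F 2F ∷ X 2F 1F ∷ []

  InQ-genericS₅ : ∀ {X} → InQ ℝ S₅ X → ∀ i j → X i j ≡ evalMatrix genericS₅ (entries X) i j
  InQ-genericS₅ X∈Q 0F 0F = refl
  InQ-genericS₅ X∈Q 0F 1F = refl
  InQ-genericS₅ X∈Q 0F 2F = X∈Q 0F 2F
  InQ-genericS₅ X∈Q 1F 0F = refl
  InQ-genericS₅ X∈Q 1F 1F = X∈Q 1F 1F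
  InQ-genericS₅ X∈Q 1F 2F = refl
  InQ-genericS₅ X∈Q 2F 0F = X∈Q 2F 0F
  InQ-genericS₅ X∈Q 2F 1F = refl
  InQ-genericS₅ X∈Q 2F 2F = X∈Q 2F 2F

  certificate : List (Polynomial 5)
  certificate =
    (a :* a :* a :+ two a :* (p :* q) :+ two a :* (d :* e) :+ a :* a) ∷ a :* a ∷ :- two a ∷ []

  -- The value of the certificate at the generic matrix: each entry is a sum of
  -- products of the positive quantities a, −p, −q, d, e.
  certificateValue : SymbolicMatrix 5 3
  certificateValue 0F 0F = two a :* (d :* e) :+ a :* a
  certificateValue 0F 1F = (:- p) :* (a :* a)
  certificateValue 0F 2F = two a :* ((:- p) :* d)
  certificateValue 1F 0F = (:- q) :* (a :* a)
  certificateValue 1F 1F = a :* a :* a :+ a :* a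
  certificateValue 1F 2F = a :* a :* d
  certificateValue 2F 0F = two a :* ((:- q) :* e)
  certificateValue 2F 1F = a :* a :* e
  certificateValue 2F 2F = a :* a :* a :+ two a :* ((:- p) :* (:- q)) :+ a :* a

  certificate-value : ∀ i j → normalise (symbolicEvalPoly certificate genericS₅ i j)
                            ≡ normalise (certificateValue i j)
  certificate-value 0F 0F = refl
  certificate-value 0F 1F = refl
  certificate-value 0F 2F = refl
  certificate-value 1F 0F = refl
  certificate-value 1F 1F = refl
  certificate-value 1F 2F = refl
  certificate-value 2F 0F = refl
  certificate-value 2F 1F = refl
  certificate-value 2F 2F = refl

  certificateValue-positive : ∀ {X} → InQ ℝ S₅ X → ∀ i j → 0# < ⟦ certificateValue i j ⟧ (entries X)
  certificateValue-positive {X} X∈Q = λ where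
      0F 0F → +-pos (*-pos 0<2a (*-pos 0<d 0<e)) 0<a²
      0F 1F → *-pos 0<-p 0<a²
      0F 2F → *-pos 0<2a (*-pos 0<-p 0<d)
      1F 0F → *-pos 0<-q 0<a²
      1F 1F → +-pos (*-pos 0<a² 0<a) 0<a²
      1F 2F → *-pos 0<a² 0<d
      2F 0F → *-pos 0<2a (*-pos 0<-q 0<e)
      2F 1F → *-pos 0<a² 0<e
      2F 2F → +-pos (+-pos (*-pos 0<a² 0<a) (*-pos 0<2a (*-pos 0<-p 0<-q))) 0<a²
    where
    a′ p′ q′ d′ e′ : Carrier
    a′ = X 0F 0F
    p′ = X 0F 1F
    q′ = X 1F 0F
    d′ = X 1F 2F
    e′ = X 2F 1F
    0<a : 0# < a′
    0<a = X∈Q 0F 0F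
    0<-p : 0# < - p′
    0<-p = neg-pos (X∈Q 0F 1F)
    0<-q : 0# < - q′
    0<-q = neg-pos (X∈Q 1F 0F)
    0<d : 0# < d′
    0<d = X∈Q 1F 2F
    0<e : 0# < e′
    0<e = X∈Q 2F 1F
    0<2a : 0# < a′ + a′
    0<2a = +-pos 0<a 0<a
    0<a² : 0# < a′ * a′
    0<a² = *-pos 0<a 0<a

  certificateAt : Matrix ℝ 3 → Poly ℝ
  certificateAt X = List.map (λ c → ⟦ c ⟧ (entries X)) certificate

  certificate-at : ∀ {X} → InQ ℝ S₅ X → ∀ i j →
                   evalPoly ℝ (certificateAt X) X i j ≡ ⟦ certificateValue i j ⟧ (entries X)
  certificate-at {X} X∈Q i j = begin
    evalPoly ℝ (certificateAt X) X i j                         ≡⟨ evalPoly-cong (certificateAt X) (InQ-genericS₅ X∈Q) i j ⟩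
    evalPoly ℝ (certificateAt X) (evalMatrix genericS₅ ρ) i j  ≡⟨ evalMatrix-evalPoly certificate genericS₅ ρ i j ⟨
    ⟦ symbolicEvalPoly certificate genericS₅ i j ⟧ ρ           ≡⟨ by-solver ⟩
    ⟦ certificateValue i j ⟧ ρ                                 ∎
    where
    open ≡-Reasoning
    ρ : Vec Carrier 5
    ρ = entries X
    by-solver : ⟦ symbolicEvalPoly certificate genericS₅ i j ⟧ ρ ≡ ⟦ certificateValue i j ⟧ ρ
    by-solver = equal-by-normalisation (symbolicEvalPoly certificate genericS₅ i j)
                                       (certificateValue i j) (certificate-value i j) ρ

mainTheorem5 : (ℝ : RealField) → RequiresAlgebraicPositivity ℝ S₅
mainTheorem5 ℝ X X∈Q =
  certificateAt X ,
  λ i j → subst (0# <_) (sym (certificate-at X∈Q i j)) (certificateValue-positive X∈Q i j)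
  where
  open RealField ℝ using (0#; _<_)
  open ≡ using (subst; sym)
  open PatternS₅ ℝ
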